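{- Let $n\geq 2$ be an integer, let $\vec x$ and $\vec y$ be distinct nonadjacent vertices of the graph $\widehat H_n$, and let $f\colon\mathbb F_2^n\to\mathbb F_2$ be any function. If $\vec x$ lies in a $2$-cycle of the phase space $\Gamma([K_n,f,\mathrm{id}])$, then $\vec y$ does not lie in a $2$-cycle of $\Gamma([K_n,f,\mathrm{id}])$.
   Context: For $f\colon\mathbb F_2^n\to\mathbb F_2$ and $i\in\{1,\ldots,n\}$, let $L_i\colon\mathbb F_2^n\to\mathbb F_2^n$ be $L_i(x_1,\ldots,x_n)=(x_1,\ldots,x_{i-1},f(x_1,\ldots,x_n),x_{i+1},\ldots,x_n)$. With $\mathrm{id}=12\cdots n$ the identity permutation, the SDS map is $F=[K_n,f,\mathrm{id}]=L_n\circ L_{n-1}\circ\cdots\circ L_1$. The phase space $\Gamma(F)$ is the directed graph on vertex set $\mathbb F_2^n$ with an edge $\vec x\to F(\vec x)$ for each $\vec x$; a $2$-cycle is a set $\{\vec x,F(\vec x)\}$ with $F(\vec x)\neq\vec x$ and $F(F(\vec x))=\vec x$. A vector $(y_1,\ldots,y_n)\in\mathbb F_2^n$ contains the subsequence $101$ if there exist indices $i_1<i_2<i_3$ with $y_{i_1}=1$, $y_{i_2}=0$, $y_{i_3}=1$. The graph $\widehat H_n$ is the simple undirected graph whose vertex set is $\{(x_1,\ldots,x_n)\in\mathbb F_2^n: x_1=0\}$, with $\vec x,\vec y$ adjacent iff $\vec x\neq\vec y$ and $\vec x+\vec y$ contains the subsequence $101$. -}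

module Defs where

open import Data.Bool using (Bool; true; false; _xor_)
open import Data.Nat using (ℕ; suc)
open import Data.Fin using (Fin; _<_)
open import Data.Vec using (Vec; lookup; _[_]≔_; zipWith; allFin; head)
open import Data.List using (foldl)
open import Data.Vec using (toList)
open import Data.Product using (∃-syntax; _×_)
open import Relation.Binary.PropositionalEquality using (_≡_; _≢_)

-- F₂ is modelled by Bool, with addition = xor; F₂ⁿ = Vec Bool n.

L : ∀ {n} → (Vec Bool n → Bool) → Fin n → Vec Bool n → Vec Bool n
L f i x = x [ i ]≔ f x

-- SDS map [K_n, f, id] = L_n ∘ ⋯ ∘ L_1 (apply L_1 first, then L_2, …).
SDS : ∀ {n} → (Vec Bool n → Bool) → Vec Bool n → Vec Bool n
SDS {n} f x = foldl (λ v i → L f i v) x (toList (allFin n))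

InTwoCycle : ∀ {n} → (Vec Bool n → Vec Bool n) → Vec Bool n → Set
InTwoCycle F x = (F x ≢ x) × (F (F x) ≡ x)

_⊕_ : ∀ {n} → Vec Bool n → Vec Bool n → Vec Bool n
_⊕_ = zipWith _xor_

Contains101 : ∀ {n} → Vec Bool n → Set
Contains101 {n} y = ∃[ i ] ∃[ j ] ∃[ k ]
  (i < j × j < k × lookup y i ≡ true × lookup y j ≡ false × lookup y k ≡ true)

IsVertexĤ : ∀ {m} → Vec Bool (suc m) → Set
IsVertexĤ x = head x ≡ false

AdjĤ : ∀ {n} → Vec Bool n → Vec Bool n → Set
AdjĤ x y = x ≢ y × Contains101 (x ⊕ y)

-- If F(x) and x agree in coordinate k, the sequential update rule forces them to agree in
-- coordinate k + 1, and (through F(F(x)) = x) the last coordinate feeds back into the first;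
-- so a point x of a 2-cycle is mapped to its complement x̄. Hence f, evaluated at the k-th
-- intermediate state of the sweep x → x̄, returns x̄ₖ, and at the k-th intermediate state of
-- the sweep x̄ → x it returns xₖ. If x and y both lie in 2-cycles and x + y avoids 101, then
-- x + y is the indicator of an interval [a, c). The a-th state of the sweep y → ȳ is the c-th
-- state of the sweep x → x̄, and the a-th state of x̄ → x is the c-th state of ȳ → y; evaluating
-- f at them gives xₐ = ¬ x_c and xₐ = x_c.
module Submission where

open import Defs
open import Data.Bool using (Bool; true; false; not; _xor_)
open import Data.Bool.Properties using (¬-not; not-¬; not-involutive)
open import Data.Nat using (ℕ; zero; suc; _≤_; _<_; z≤n; s≤s; _≤′_; ≤′-refl; ≤′-step)
open import Data.Nat.Properties
  using (≤-refl; ≤-trans; ≤-pred; <⇒≤; <-trans; <-≤-trans; ≮⇒≥; ≤∧≢⇒<; n<1+n; m<n⇒m<1+n;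
         m≤n⇒m<n∨m≡n; ≤⇒≤′; _<?_)
open import Data.Vec using (Vec; []; _∷_; lookup; map; head; tabulate; toList)
open import Data.Fin using (Fin; fromℕ<) renaming (suc to fsuc)
open import Data.Fin.Properties using (toℕ-fromℕ<)
open import Data.List using (foldl)
open import Data.Product using (∃-syntax; ∃₂; _×_; _,_; proj₁; proj₂)
open import Data.Sum using (inj₁; inj₂)
open import Data.Empty using (⊥-elim)
open import Function using (_∘_)
open import Relation.Binary.PropositionalEquality
open import Relation.Nullary using (¬_; yes; no; contradiction)

-- Coordinates are indexed by ℕ, and every coordinate beyond the last one reads as 1.  For a
-- vector with first coordinate 0 this makes position n play the role of the first coordinate
-- of the complement, which is where the sweeps below wrap around.
at : ∀ {n} → Vec Bool n → ℕ → Bool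
at []      _       = true
at (a ∷ _) zero    = a
at (_ ∷ v) (suc k) = at v k

at-ext : ∀ {n} (v w : Vec Bool n) → (∀ j → j < n → at v j ≡ at w j) → v ≡ w
at-ext []      []      _  = refl
at-ext (a ∷ v) (b ∷ w) eq = cong₂ _∷_ (eq 0 (s≤s z≤n)) (at-ext v w (λ j q → eq (suc j) (s≤s q)))

at-≥ : ∀ {n} (v : Vec Bool n) j → n ≤ j → at v j ≡ true
at-≥ []      _       _       = refl
at-≥ (_ ∷ v) (suc j) (s≤s q) = at-≥ v j q

at-zero : ∀ {m} (v : Vec Bool (suc m)) → at v 0 ≡ head v
at-zero (_ ∷ _) = refl

at-map-not : ∀ {n} (v : Vec Bool n) j → j < n → at (map not v) j ≡ not (at v j)
at-map-not (_ ∷ _) zero    _       = refl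
at-map-not (_ ∷ v) (suc j) (s≤s q) = at-map-not v j q

splice : ∀ {n} → ℕ → Vec Bool n → Vec Bool n → Vec Bool n
splice zero    _       x       = x
splice (suc _) []      []      = []
splice (suc k) (a ∷ z) (_ ∷ x) = a ∷ splice k z x

at-splice-< : ∀ {n} k j (z x : Vec Bool n) → j < k → at (splice k z x) j ≡ at z j
at-splice-< (suc k) j       []      []      _       = refl
at-splice-< (suc k) zero    (_ ∷ _) (_ ∷ _) _       = refl
at-splice-< (suc k) (suc j) (_ ∷ z) (_ ∷ x) (s≤s q) = at-splice-< k j z x q

at-splice-≥ : ∀ {n} k j (z x : Vec Bool n) → k ≤ j → at (splice k z x) j ≡ at x j
at-splice-≥ zero    _       _       _       _       = refl
at-splice-≥ (suc k) _       []      []      _       = refl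
at-splice-≥ (suc k) (suc j) (_ ∷ z) (_ ∷ x) (s≤s q) = at-splice-≥ k j z x q

splice-≥ : ∀ {n} k (z x : Vec Bool n) → n ≤ k → splice k z x ≡ z
splice-≥ zero    []      []      _       = refl
splice-≥ (suc k) []      []      _       = refl
splice-≥ (suc k) (a ∷ z) (_ ∷ x) (s≤s q) = cong (a ∷_) (splice-≥ k z x q)

splice-suc : ∀ {n} k (z x : Vec Bool n) → at z k ≡ at x k → splice (suc k) z x ≡ splice k z x
splice-suc zero    []      []      _  = refl
splice-suc (suc k) []      []      _  = refl
splice-suc zero    (_ ∷ _) (_ ∷ x) eq = cong (_∷ x) eq
splice-suc (suc k) (a ∷ z) (_ ∷ x) eq = cong (a ∷_) (splice-suc k z x eq)

data Position (a c j : ℕ) : Set where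
  before : j < a → Position a c j
  within : a ≤ j → j < c → Position a c j
  after  : c ≤ j → Position a c j

position : ∀ a c j → Position a c j
position a c j with j <? a | j <? c
... | yes j<a | _       = before j<a
... | no  j≮a | yes j<c = within (≮⇒≥ j≮a) j<c
... | no  _   | no  j≮c = after (≮⇒≥ j≮c)

splice-≡ : ∀ {n a c} (z x z′ x′ : Vec Bool n) → a ≤ c →
  (∀ j → j < n → j < a → at z j ≡ at z′ j) →
  (∀ j → j < n → a ≤ j → j < c → at x j ≡ at z′ j) →
  (∀ j → j < n → c ≤ j → at x j ≡ at x′ j) →
  splice a z x ≡ splice c z′ x′
splice-≡ {n} {a} {c} z x z′ x′ a≤c eq-before eq-within eq-after = at-ext _ _ pointwise
  where
  pointwise : ∀ j → j < n → at (splice a z x) j ≡ at (splice c z′ x′) j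
  pointwise j j<n with position a c j
  ... | before j<a = begin
    at (splice a z x) j    ≡⟨ at-splice-< a j z x j<a ⟩
    at z j                 ≡⟨ eq-before j j<n j<a ⟩
    at z′ j                ≡⟨ at-splice-< c j z′ x′ (<-≤-trans j<a a≤c) ⟨
    at (splice c z′ x′) j  ∎
    where open ≡-Reasoning
  ... | within a≤j j<c = begin
    at (splice a z x) j    ≡⟨ at-splice-≥ a j z x a≤j ⟩
    at x j                 ≡⟨ eq-within j j<n a≤j j<c ⟩
    at z′ j                ≡⟨ at-splice-< c j z′ x′ j<c ⟨
    at (splice c z′ x′) j  ∎
    where open ≡-Reasoning
  ... | after c≤j = begin
    at (splice a z x) j    ≡⟨ at-splice-≥ a j z x (≤-trans a≤c c≤j) ⟩
    at x j                 ≡⟨ eq-after j j<n c≤j ⟩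
    at x′ j                ≡⟨ at-splice-≥ c j z′ x′ c≤j ⟨
    at (splice c z′ x′) j  ∎
    where open ≡-Reasoning

SDS-∷ : ∀ {m} (f : Vec Bool (suc m) → Bool) a v →
  SDS f (a ∷ v) ≡ f (a ∷ v) ∷ SDS (λ t → f (f (a ∷ v) ∷ t)) v
SDS-∷ f a v = sweep-∷ (λ i → i) (f (a ∷ v)) v
  where
  sweep-∷ : ∀ {m k} {f : Vec Bool (suc m) → Bool} (ι : Fin k → Fin m) b v →
    foldl (λ w i → L f i w) (b ∷ v) (toList (tabulate (fsuc ∘ ι))) ≡
    b ∷ foldl (λ w i → L (λ t → f (b ∷ t)) i w) v (toList (tabulate ι))
  sweep-∷ {k = zero}  ι b v = refl
  sweep-∷ {k = suc k} ι b v = sweep-∷ (ι ∘ fsuc) b _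

SDS-at : ∀ {n} (f : Vec Bool n → Bool) (x : Vec Bool n) k → k < n →
  f (splice k (SDS f x) x) ≡ at (SDS f x) k
SDS-at f (a ∷ v) zero    _       rewrite SDS-∷ f a v = refl
SDS-at f (a ∷ v) (suc k) (s≤s q) rewrite SDS-∷ f a v = SDS-at (λ t → f (f (a ∷ v) ∷ t)) v k q

module TwoCycle {m} (f : Vec Bool (suc m) → Bool) {x : Vec Bool (suc m)}
                (cycle : InTwoCycle (SDS f) x) where

  private
    z : Vec Bool (suc m)
    z = SDS f x

    forward : ∀ k → k < suc m → f (splice k z x) ≡ at z k
    forward = SDS-at f x

    backward : ∀ k → k < suc m → f (splice k x z) ≡ at x k
    backward k k<n = subst (λ w → f (splice k w z) ≡ at w k) (proj₂ cycle) (SDS-at f z k k<n)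

    Agree : ℕ → Set
    Agree k = at z k ≡ at x k

    agree-suc : ∀ k → suc k < suc m → Agree k → Agree (suc k)
    agree-suc k q eq = begin
      at z (suc k)            ≡⟨ forward (suc k) q ⟨
      f (splice (suc k) z x)  ≡⟨ cong f (splice-suc k z x eq) ⟩
      f (splice k z x)        ≡⟨ forward k k<n ⟩
      at z k                  ≡⟨ eq ⟩
      at x k                  ≡⟨ backward k k<n ⟨
      f (splice k x z)        ≡⟨ cong f (splice-suc k x z (sym eq)) ⟨
      f (splice (suc k) x z)  ≡⟨ backward (suc k) q ⟩
      at x (suc k)            ∎
      where
      open ≡-Reasoning
      k<n = <-trans (n<1+n k) q

    agree-wrap : Agree m → Agree 0
    agree-wrap eq = begin
      at z 0                  ≡⟨ forward 0 (s≤s z≤n) ⟨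
      f x                     ≡⟨ cong f (splice-≥ (suc m) x z ≤-refl) ⟨
      f (splice (suc m) x z)  ≡⟨ cong f (splice-suc m x z (sym eq)) ⟩
      f (splice m x z)        ≡⟨ backward m ≤-refl ⟩
      at x m                  ≡⟨ eq ⟨
      at z m                  ≡⟨ forward m ≤-refl ⟨
      f (splice m z x)        ≡⟨ cong f (splice-suc m z x eq) ⟨
      f (splice (suc m) z x)  ≡⟨ cong f (splice-≥ (suc m) z x ≤-refl) ⟩
      f z                     ≡⟨ backward 0 (s≤s z≤n) ⟩
      at x 0                  ∎
      where open ≡-Reasoning

    agree-upward : ∀ {k j} → k ≤′ j → j < suc m → Agree k → Agree j
    agree-upward ≤′-refl        _ eq = eq
    agree-upward (≤′-step k≤′j) q eq = agree-suc _ q (agree-upward k≤′j (<-trans (n<1+n _) q) eq)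

    disagree : ∀ k → k < suc m → ¬ Agree k
    disagree k k<n eq = proj₁ cycle (at-ext z x everywhere)
      where
      everywhere : ∀ j → j < suc m → Agree j
      everywhere j j<n =
        agree-upward (≤⇒≤′ z≤n) j<n (agree-wrap (agree-upward (≤⇒≤′ (≤-pred k<n)) ≤-refl eq))

  complement : SDS f x ≡ map not x
  complement = at-ext z (map not x) λ j j<n → trans (¬-not (disagree j j<n)) (sym (at-map-not x j j<n))

  module _ (x₀ : head x ≡ false) where

    outbound : ∀ k → k ≤ suc m → f (splice k (map not x) x) ≡ not (at x k)
    outbound k k≤n with m≤n⇒m<n∨m≡n k≤n
    ... | inj₁ k<n = begin
      f (splice k (map not x) x)  ≡⟨ cong (λ w → f (splice k w x)) complement ⟨
      f (splice k z x)            ≡⟨ forward k k<n ⟩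
      at z k                      ≡⟨ cong (λ w → at w k) complement ⟩
      at (map not x) k            ≡⟨ at-map-not x k k<n ⟩
      not (at x k)                ∎
      where open ≡-Reasoning
    ... | inj₂ refl = begin
      f (splice k (map not x) x)  ≡⟨ cong f (splice-≥ k (map not x) x ≤-refl) ⟩
      f (map not x)               ≡⟨ cong f complement ⟨
      f z                         ≡⟨ backward 0 (s≤s z≤n) ⟩
      at x 0                      ≡⟨ trans (at-zero x) x₀ ⟩
      false                       ≡⟨ cong not (at-≥ x k ≤-refl) ⟨
      not (at x k)                ∎
      where open ≡-Reasoning

    inbound : ∀ k → k ≤ suc m → f (splice k x (map not x)) ≡ at x k
    inbound k k≤n with m≤n⇒m<n∨m≡n k≤n
    ... | inj₁ k<n = subst (λ w → f (splice k x w) ≡ at x k) complement (backward k k<n)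
    ... | inj₂ refl = begin
      f (splice k x (map not x))  ≡⟨ cong f (splice-≥ k x (map not x) ≤-refl) ⟩
      f x                         ≡⟨ forward 0 (s≤s z≤n) ⟩
      at z 0                      ≡⟨ cong (λ w → at w 0) complement ⟩
      at (map not x) 0            ≡⟨ at-map-not x 0 (s≤s z≤n) ⟩
      not (at x 0)                ≡⟨ cong not (trans (at-zero x) x₀) ⟩
      true                        ≡⟨ at-≥ x k ≤-refl ⟨
      at x k                      ∎
      where open ≡-Reasoning

Has101 : (ℕ → Bool) → Set
Has101 p = ∃[ i ] ∃[ j ] ∃[ k ] (i < j × j < k × p i ≡ true × p j ≡ false × p k ≡ true)

record IsIndicator (p : ℕ → Bool) (a c : ℕ) : Set where
  field
    false-before : ∀ j → j < a → p j ≡ false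
    true-within  : ∀ j → a ≤ j → j < c → p j ≡ true
    false-after  : ∀ j → c ≤ j → p j ≡ false

least-true : (p : ℕ → Bool) → ∀ {w} → p w ≡ true →
  ∃[ a ] (p a ≡ true × ∀ j → j < a → p j ≡ false)
least-true p {zero} t = 0 , t , λ _ ()
least-true p {suc w} t with p 0 in p0
... | true  = 0 , p0 , λ _ ()
... | false with least-true (p ∘ suc) t
...   | a , ta , below = suc a , ta , λ { zero _ → p0 ; (suc j) (s≤s j<a) → below j j<a }

greatest-true : (p : ℕ → Bool) (N : ℕ) → (∀ j → N ≤ j → p j ≡ false) → ∀ {w} → p w ≡ true →
  ∃[ b ] (b < N × p b ≡ true × ∀ j → b < j → p j ≡ false)
greatest-true p zero    vanishes t = contradiction (vanishes _ z≤n) (not-¬ t)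
greatest-true p (suc N) vanishes t with p N in pN
... | true  = N , n<1+n N , pN , vanishes
... | false =
  let b , b<N , tb , above = greatest-true p N vanishes-from-N t in b , m<n⇒m<1+n b<N , tb , above
  where
  vanishes-from-N : ∀ j → N ≤ j → p j ≡ false
  vanishes-from-N j N≤j with m≤n⇒m<n∨m≡n N≤j
  ... | inj₁ N<j = vanishes j N<j
  ... | inj₂ refl = pN

true-interval : (p : ℕ → Bool) (N : ℕ) → (∀ j → N ≤ j → p j ≡ false) → ¬ Has101 p →
  ∀ {w} → p w ≡ true → ∃₂ λ a c → a < c × c ≤ N × IsIndicator p a c
true-interval p N vanishes no101 t with least-true p t | greatest-true p N vanishes t
... | a , ta , below | b , b<N , tb , above = a , suc b , s≤s a≤b , b<N , record
  { false-before = below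
  ; true-within  = between
  ; false-after  = above
  }
  where
  a≤b : a ≤ b
  a≤b = ≮⇒≥ λ b<a → not-¬ tb (below b b<a)

  between : ∀ j → a ≤ j → j < suc b → p j ≡ true
  between j a≤j j<1+b with p j in pj
  ... | true  = refl
  ... | false = ⊥-elim (no101 (a , j , b , a<j , j<b , ta , pj , tb))
    where
    a<j = ≤∧≢⇒< a≤j λ { refl → not-¬ ta pj }
    j<b = ≤∧≢⇒< (≤-pred j<1+b) λ { refl → not-¬ tb pj }

diff : ∀ {n} → Vec Bool n → Vec Bool n → ℕ → Bool
diff x y j = at x j xor at y j

diff-≥ : ∀ {n} (x y : Vec Bool n) j → n ≤ j → diff x y j ≡ false
diff-≥ x y j n≤j rewrite at-≥ x j n≤j | at-≥ y j n≤j = refl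

diff-true⇒< : ∀ {n} (x y : Vec Bool n) j → diff x y j ≡ true → j < n
diff-true⇒< []      []      _       ()
diff-true⇒< (_ ∷ _) (_ ∷ _) zero    _ = s≤s z≤n
diff-true⇒< (_ ∷ x) (_ ∷ y) (suc j) d = s≤s (diff-true⇒< x y j d)

diff-false⇒≡ : ∀ {n} (x y : Vec Bool n) j → diff x y j ≡ false → at x j ≡ at y j
diff-false⇒≡ x y j d with at x j | at y j
... | false | false = refl
... | true  | true  = refl

diff-true⇒≡not : ∀ {n} (x y : Vec Bool n) j → diff x y j ≡ true → at y j ≡ not (at x j)
diff-true⇒≡not x y j d with at x j | at y j
... | false | true  = refl
... | true  | false = refl

differs-somewhere : ∀ {n} (x y : Vec Bool n) → x ≢ y → ∃[ j ] diff x y j ≡ true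
differs-somewhere []      []      x≢y = contradiction refl x≢y
differs-somewhere (a ∷ x) (b ∷ y) x≢y with a xor b in d
... | true  = 0 , d
... | false =
  let j , dj = differs-somewhere x y (x≢y ∘ cong₂ _∷_ (diff-false⇒≡ (a ∷ x) (b ∷ y) 0 d))
  in suc j , dj

lookup-⊕ : ∀ {n} (x y : Vec Bool n) {j} (j<n : j < n) → lookup (x ⊕ y) (fromℕ< j<n) ≡ diff x y j
lookup-⊕ (_ ∷ _) (_ ∷ _) {zero}  _         = refl
lookup-⊕ (_ ∷ x) (_ ∷ y) {suc j} (s≤s j<n) = lookup-⊕ x y j<n

Has101-diff⇒Contains101 : ∀ {n} (x y : Vec Bool n) → Has101 (diff x y) → Contains101 (x ⊕ y)
Has101-diff⇒Contains101 x y (i , j , k , i<j , j<k , di , dj , dk) =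
  fromℕ< i<n , fromℕ< j<n , fromℕ< k<n ,
  subst₂ _<_ (sym (toℕ-fromℕ< i<n)) (sym (toℕ-fromℕ< j<n)) i<j ,
  subst₂ _<_ (sym (toℕ-fromℕ< j<n)) (sym (toℕ-fromℕ< k<n)) j<k ,
  trans (lookup-⊕ x y i<n) di , trans (lookup-⊕ x y j<n) dj , trans (lookup-⊕ x y k<n) dk
  where
  k<n = diff-true⇒< x y k dk
  j<n = <-trans j<k k<n
  i<n = <-trans i<j j<n

twoCycles-diff-not-interval : ∀ {m} (f : Vec Bool (suc m) → Bool) {x y : Vec Bool (suc m)} →
  head x ≡ false → head y ≡ false → InTwoCycle (SDS f) x → InTwoCycle (SDS f) y →
  ∀ {a c} → a < c → c ≤ suc m → ¬ IsIndicator (diff x y) a c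
twoCycles-diff-not-interval f {x} {y} x₀ y₀ x-cycle y-cycle {a} {c} a<c c≤n I =
  not-¬ same-parity opposite-parity
  where
  open IsIndicator I
  module X = TwoCycle f x-cycle
  module Y = TwoCycle f y-cycle

  a≤n = <⇒≤ (<-≤-trans a<c c≤n)

  agree-before : ∀ j → j < a → at x j ≡ at y j
  agree-before j j<a = diff-false⇒≡ x y j (false-before j j<a)

  flipped-within : ∀ j → a ≤ j → j < c → at y j ≡ not (at x j)
  flipped-within j a≤j j<c = diff-true⇒≡not x y j (true-within j a≤j j<c)

  agree-after : ∀ j → c ≤ j → at x j ≡ at y j
  agree-after j c≤j = diff-false⇒≡ x y j (false-after j c≤j)

  outbound-states : splice a (map not y) y ≡ splice c (map not x) x
  outbound-states = splice-≡ (map not y) y (map not x) x (<⇒≤ a<c)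
    (λ j j<n j<a → trans (at-map-not y j j<n)
                     (trans (cong not (sym (agree-before j j<a))) (sym (at-map-not x j j<n))))
    (λ j j<n a≤j j<c → trans (flipped-within j a≤j j<c) (sym (at-map-not x j j<n)))
    (λ j _ c≤j → sym (agree-after j c≤j))

  inbound-states : splice a x (map not x) ≡ splice c y (map not y)
  inbound-states = splice-≡ x (map not x) y (map not y) (<⇒≤ a<c)
    (λ j _ j<a → agree-before j j<a)
    (λ j j<n a≤j j<c → trans (at-map-not x j j<n) (sym (flipped-within j a≤j j<c)))
    (λ j j<n c≤j → trans (at-map-not x j j<n)
                     (trans (cong not (agree-after j c≤j)) (sym (at-map-not y j j<n))))

  opposite-parity : at x a ≡ not (at x c)
  opposite-parity = begin
    at x a                      ≡⟨ not-involutive (at x a) ⟨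
    not (not (at x a))          ≡⟨ cong not (flipped-within a ≤-refl a<c) ⟨
    not (at y a)                ≡⟨ Y.outbound y₀ a a≤n ⟨
    f (splice a (map not y) y)  ≡⟨ cong f outbound-states ⟩
    f (splice c (map not x) x)  ≡⟨ X.outbound x₀ c c≤n ⟩
    not (at x c)                ∎
    where open ≡-Reasoning

  same-parity : at x a ≡ at x c
  same-parity = begin
    at x a                      ≡⟨ X.inbound x₀ a a≤n ⟨
    f (splice a x (map not x))  ≡⟨ cong f inbound-states ⟩
    f (splice c y (map not y))  ≡⟨ Y.inbound y₀ c c≤n ⟩
    at y c                      ≡⟨ agree-after c ≤-refl ⟨
    at x c                      ∎
    where open ≡-Reasoning

lemma3 : (m : ℕ) → 1 ≤ m → (x y : Vec Bool (suc m)) → IsVertexĤ x → IsVertexĤ y → x ≢ y → ¬ AdjĤ x y →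
    (f : Vec Bool (suc m) → Bool) → InTwoCycle (SDS f) x → ¬ InTwoCycle (SDS f) y
lemma3 m _ x y x₀ y₀ x≢y nonadjacent f x-cycle y-cycle
  with differs-somewhere x y x≢y
... | _ , differ
  with true-interval (diff x y) (suc m) (diff-≥ x y)
         (nonadjacent ∘ (x≢y ,_) ∘ Has101-diff⇒Contains101 x y) differ
...   | _ , _ , a<c , c≤n , indicator =
  twoCycles-diff-not-interval f x₀ y₀ x-cycle y-cycle a<c c≤n indicator
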